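{- Let $k \geq 2$ be an integer and let $s = (s(i))_{i \geq 0}$ be a $k$-automatic sequence over $\{0,1\}$. Then the sequence $\mathrm{sum}_s$ is $k$-synchronised if and only if the sequence $\mathrm{ind}_s$ is $k$-synchronised.
   Context: For a binary sequence $s$, $\mathrm{sum}_s(n) = \sum_{i=0}^{n} s(i)$ is its running sum, and $\mathrm{ind}_s$ is the sequence, in increasing order, of the indices $i$ at which $s(i) = 1$ (for the Thue–Morse sequence $0,1,1,0,1,0,0,1,\dots$ this is $1,2,4,7,\dots$). A (possibly finite) sequence $f$ of natural numbers is $k$-synchronised if there is a finite automaton which, reading the base-$k$ representations of $n$ and $m$ in parallel (most significant digit first, the shorter one padded with leading zeros), accepts exactly the pairs $(n,m)$ with $m = f(n)$. -}

module Defs where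

open import Data.Bool using (Bool; true; false)
open import Data.Fin using (Fin; toℕ)
open import Data.List using (List; []; _∷_; reverse; length; replicate; _++_; zip; foldl)
open import Data.Nat using (ℕ; zero; suc; _+_; _∸_; _≟_; NonZero)
open import Data.Nat.DivMod using (_/_; _mod_)
open import Data.Product using (Σ; _×_; _,_)
open import Function.Bundles using (_⇔_)
open import Relation.Binary.PropositionalEquality using (_≡_)
open import Relation.Nullary using (yes; no)

record DFAO (A O : Set) : Set where
  field
    nStates : ℕ
    start   : Fin nStates
    δ       : Fin nStates → A → Fin nStates
    out     : Fin nStates → O

runDFAO : {A O : Set} → DFAO A O → List A → O
runDFAO M w = DFAO.out M (foldl (DFAO.δ M) (DFAO.start M) w)

-- Base-k digits of n, least significant first; the fuel argument
-- (taken to be n) only ensures termination.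
digitsLSD : (k : ℕ) .{{_ : NonZero k}} → ℕ → ℕ → List (Fin k)
digitsLSD k zero    n = []
digitsLSD k (suc f) n with n ≟ 0
... | yes _ = []
... | no  _ = (n mod k) ∷ digitsLSD k f (n / k)

-- Canonical base-k representation of n, most significant digit first
-- (no leading zeros; the representation of 0 is the empty word).
rep : (k : ℕ) .{{_ : NonZero k}} → ℕ → List (Fin k)
rep k n = reverse (digitsLSD k n n)

padTo : (k : ℕ) .{{_ : NonZero k}} → ℕ → List (Fin k) → List (Fin k)
padTo k len w = replicate (len ∸ length w) (0 mod k) ++ w

pairRep : (k : ℕ) .{{_ : NonZero k}} → ℕ → ℕ → List (Fin k × Fin k)
pairRep k n m =
  let u = rep k n ; v = rep k m ; L = length u Data.Nat.⊔ length v
  in zip (padTo k L u) (padTo k L v)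

Automatic : (k : ℕ) .{{_ : NonZero k}} → (ℕ → Fin 2) → Set
Automatic k s = Σ (DFAO (Fin k) (Fin 2)) λ M → (n : ℕ) → runDFAO M (rep k n) ≡ s n

-- A (possibly partial / finite) sequence given by its graph G
-- (G n m  means  f(n) = m) is k-synchronised: some automaton reading
-- (n , m) in parallel accepts exactly the pairs with G n m.
Synchronised : (k : ℕ) .{{_ : NonZero k}} → (ℕ → ℕ → Set) → Set
Synchronised k G =
  Σ (DFAO (Fin k × Fin k) Bool) λ M →
    (n m : ℕ) → (runDFAO M (pairRep k n m) ≡ true) ⇔ G n m

sumSeq : (ℕ → Fin 2) → ℕ → ℕ
sumSeq s zero    = toℕ (s 0)
sumSeq s (suc n) = sumSeq s n + toℕ (s (suc n))

onesBelow : (ℕ → Fin 2) → ℕ → ℕ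
onesBelow s zero    = 0
onesBelow s (suc m) = onesBelow s m + toℕ (s m)

SumGraph : (ℕ → Fin 2) → ℕ → ℕ → Set
SumGraph s n m = m ≡ sumSeq s n

-- Graph of ind_s (0-indexed): ind_s(n) = m iff m is the (n+1)-st index
-- i with s(i) = 1, i.e. s(m) = 1 and exactly n ones occur before m.
-- Defined only for n below the number of ones (ind_s may be finite).
IndGraph : (ℕ → Fin 2) → ℕ → ℕ → Set
IndGraph s n m = (toℕ (s m) ≡ 1) × (onesBelow s m ≡ n)

{-# OPTIONS --safe #-}
module Submission where

-- Both graphs are definable from each other by formulas that finite automata reading base-k
-- numerals in parallel can evaluate.  With the ones of s counted from 0,
--   ind_s(n) = m  iff  s(m) = 1 and (n = m = 0, or m = y + 1 with sum_s(y) = n),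
--   sum_s(n) = m  iff  ind_s(m) ≤ n fails, and m = 0 or ind_s(m - 1) ≤ n,
-- where "ind_s(m) ≤ n" is ∃ z ≤ n. ind_s(m) = z.  Hence it suffices that recognisable relations
-- are closed under Boolean operations, permutation of tracks, replacing a track y by y - 1 (an
-- automaton that borrows), and existential quantification over a track bounded by another (a
-- subset construction; the bound makes the witness fit into the length of the input word), and
-- that x = 0, x ≤ y and s(x) = 1 are recognisable.  Words with leading zeros are harmless: the
-- shortest word of a given value is unique, so stripping leading zeros yields `rep`/`pairRep`.

open import Defs
open import Data.Fin using (Fin)
open import Data.Nat using (ℕ; _≤_; NonZero)
open import Function.Bundles using (_⇔_)

open import Data.Bool using (Bool; true; false; T; not; _∧_; _∨_; if_then_else_)
open import Data.Bool.Properties using (T-∧; T-∨; T-≡)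
open import Data.Fin as Fin using (toℕ)
open import Data.Fin.Properties
  using (*↔×; 2↔Bool; 1↔⊤; any?; toℕ<n; toℕ-injective; toℕ-fromℕ<; toℕ-fromℕ; toℕ-inject₁)
open import Data.List
  using (List; []; _∷_; _∷ʳ_; _++_; foldl; foldr; map; length; replicate; zip; dropWhileᵇ)
open import Data.List.Properties
  using ( foldl-map; foldl-∷ʳ; foldl-++; reverse-foldl
        ; length-++; length-map; length-replicate; length-zipWith; length-reverse )
open import Data.Nat
  using ( zero; suc; _+_; _∸_; _*_; _^_; _⊔_; _⊓_; _<_; _≡ᵇ_; _≟_
        ; z≤n; s≤s; s≤s⁻¹; z<s; ≢-nonZero )
open import Data.Nat.DivMod
  using (_%_; _/_; _mod_; m≡m%n+[m/n]*n; [m+kn]%n≡m%n; m<n⇒m%n≡m; m%n<n; m<n*o⇒m/o<n; m/n<m)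
open import Data.Nat.Properties
open import Data.Product using (Σ; ∃; _×_; _,_; proj₁; proj₂; uncurry; swap)
open import Data.Product.Function.NonDependent.Propositional using (_×-↪_; _×-⇔_)
open import Data.Sum using (_⊎_; inj₁; inj₂)
open import Data.Sum.Function.Propositional using (_⊎-⇔_)
open import Data.Unit using (⊤)
open import Data.Vec using (Vec; []; _∷_; lookup; tabulate)
open import Data.Vec.Properties using (lookup∘tabulate)
open import Function.Base using (_∘_; id; flip)
open import Function.Bundles using (_↪_; mk↪; mk⇔; RightInverse; Equivalence)
open import Function.Construct.Composition using (_↪-∘_)
open import Function.Properties.Inverse using (↔-sym; ↔-refl; ↔⇒↪)
import Function.Properties.Equivalence as ⇔
open import Function.Related.TypeIsomorphisms using (¬-cong-⇔)
open import Relation.Binary.Definitions using (tri<; tri≈; tri>)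
open import Relation.Binary.PropositionalEquality
open import Relation.Nullary using (¬_; Dec; yes; no; contradiction)
open import Relation.Nullary.Decidable using (T?; isYes; map′; _×-dec_; toWitness; fromWitness)
open import Relation.Unary using (Decidable)

private
  variable
    A B C V W : Set

Finite : Set → Set
Finite A = Σ ℕ λ n → A ↪ Fin n

size : Finite A → ℕ
size = proj₁

module _ {A : Set} (fin : Finite A) where
  open RightInverse (proj₂ fin)

  encode : A → Fin (size fin)
  encode = to

  decode : Fin (size fin) → A
  decode = from

  decode-encode : ∀ a → decode (encode a) ≡ a
  decode-encode = strictlyInverseʳ

finite-↪ : A ↪ B → Finite B → Finite A
finite-↪ f (n , g) = n , g ↪-∘ f

finite-Fin : ∀ {n} → Finite (Fin n)
finite-Fin = _ , ↔⇒↪ ↔-refl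

finite-Bool : Finite Bool
finite-Bool = _ , ↔⇒↪ (↔-sym 2↔Bool)

finite-× : Finite A → Finite B → Finite (A × B)
finite-× (m , f) (n , g) = m * n , ↔⇒↪ (↔-sym *↔×) ↪-∘ (f ×-↪ g)

finite-Vec : Finite A → ∀ n → Finite (Vec A n)
finite-Vec {A} _   zero    = finite-↪ nil↪ (_ , ↔⇒↪ (↔-sym 1↔⊤))
  where
  nil↪ : Vec A 0 ↪ ⊤
  nil↪ = mk↪ λ { {x = []} _ → refl }
finite-Vec {A} fin (suc n) = finite-↪ uncons↪ (finite-× fin (finite-Vec fin n))
  where
  uncons↪ : Vec A (suc n) ↪ (A × Vec A n)
  uncons↪ = mk↪ {to = λ { (a ∷ as) → a , as }} {from = uncurry _∷_} λ { {x = _ ∷ _} refl → refl }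

data Comparison : Set where
  less equal greater : Comparison

finite-Comparison : Finite Comparison
finite-Comparison =
  3 , mk↪ {to = to} {from = from} λ { {less} refl → refl ; {equal} refl → refl ; {greater} refl → refl }
  where
  to : Comparison → Fin 3
  to less    = Fin.zero
  to equal   = Fin.suc Fin.zero
  to greater = Fin.suc (Fin.suc Fin.zero)

  from : Fin 3 → Comparison
  from Fin.zero              = less
  from (Fin.suc Fin.zero)    = equal
  from (Fin.suc (Fin.suc _)) = greater

any?-finite : Finite A → {P : A → Set} → Decidable P → Dec (∃ P)
any?-finite fin {P} P? =
  map′ (λ (i , p) → decode fin i , p)
       (λ (a , p) → encode fin a , subst P (sym (decode-encode fin a)) p)
       (any? (P? ∘ decode fin))

T-lookup-tabulate : ∀ {n} {P : Fin n → Set} (P? : Decidable P) j → T (lookup (tabulate (isYes ∘ P?)) j) ⇔ P j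
T-lookup-tabulate {P = P} P? j =
  subst (λ b → T b ⇔ P j) (sym (lookup∘tabulate (isYes ∘ P?) j)) (mk⇔ toWitness fromWitness)

foldl-natural : {evA : V → A → V} {evB : W → B → W} (f : A → B) (g : V → W) →
  (∀ v a → g (evA v a) ≡ evB (g v) (f a)) → ∀ v w → g (foldl evA v w) ≡ foldl evB (g v) (map f w)
foldl-natural             f g g-ev v []      = refl
foldl-natural {evB = evB} f g g-ev v (a ∷ w) =
  trans (foldl-natural f g g-ev _ w) (cong (λ x → foldl evB x (map f w)) (g-ev v a))

_⊗_ : (V → A → V) → (W → C → W) → V × W → A × C → V × W
(ev ⊗ ev′) (v , x) (a , c) = ev v a , ev′ x c

foldl-⊗-zip : (ev : V → A → V) (ev′ : W → C → W) → ∀ v x u c → length u ≡ length c →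
  foldl (ev ⊗ ev′) (v , x) (zip u c) ≡ (foldl ev v u , foldl ev′ x c)
foldl-⊗-zip ev ev′ v x []      []       _       = refl
foldl-⊗-zip ev ev′ v x (a ∷ u) (c ∷ cs) |u|≡|c| =
  foldl-⊗-zip ev ev′ (ev v a) (ev′ x c) u cs (suc-injective |u|≡|c|)

JointlyInjective : (V → A → V) → Set
JointlyInjective ev = ∀ {v v′ a a′} → ev v a ≡ ev v′ a′ → v ≡ v′ × a ≡ a′

⊗-injective : {ev : V → A → V} {ev′ : W → C → W} →
  JointlyInjective ev → JointlyInjective ev′ → JointlyInjective (ev ⊗ ev′)
⊗-injective ev-injective ev′-injective {_ , _} {_ , _} {_ , _} {_ , _} eq
  with ev-injective (cong proj₁ eq) | ev′-injective (cong proj₂ eq)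
... | refl , refl | refl , refl = refl , refl

foldl-injective : {ev : V → A → V} → JointlyInjective ev →
  ∀ {v v′} u u′ → length u ≡ length u′ → foldl ev v u ≡ foldl ev v′ u′ → v ≡ v′ × u ≡ u′
foldl-injective ev-injective []      []        _        v≡v′ = v≡v′ , refl
foldl-injective ev-injective (a ∷ u) (a′ ∷ u′) |u|≡|u′| eq
  with foldl-injective ev-injective u u′ (suc-injective |u|≡|u′|) eq
... | ev≡ev′ , refl with ev-injective ev≡ev′
... | refl , refl = refl , refl

-- Words without leading zeros are handled as the shortest words of their value (Fits L v: v has
-- a word of length L); their uniqueness then only needs injectivity on words of equal length.
module _ {ev : V → A → V} {v₀ : V} (Fits : ℕ → V → Set) where
  Shortest : List A → Set
  Shortest u = ∀ {L} → Fits L (foldl ev v₀ u) → length u ≤ L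

  shortest-unique : (∀ u → Fits (length u) (foldl ev v₀ u)) → JointlyInjective ev →
    ∀ {u u′} → Shortest u → Shortest u′ → foldl ev v₀ u ≡ foldl ev v₀ u′ → u ≡ u′
  shortest-unique fits ev-injective {u} {u′} u-shortest u′-shortest eq =
    proj₂ (foldl-injective ev-injective u u′ (≤-antisym |u|≤|u′| |u′|≤|u|) eq)
    where
    |u|≤|u′| : length u ≤ length u′
    |u|≤|u′| = u-shortest (subst (Fits (length u′)) (sym eq) (fits u′))

    |u′|≤|u| : length u′ ≤ length u
    |u′|≤|u| = u′-shortest (subst (Fits (length u)) eq (fits u))

-- Automata

record Automaton (A : Set) : Set₁ where
  field
    State     : Set
    finite    : Finite State
    start     : State
    step      : State → A → State
    accepting : State → Bool

  accepts : List A → Bool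
  accepts w = accepting (foldl step start w)

open Automaton

module _ (M : Automaton A) where
  encodedStep : Fin (size (finite M)) → A → Fin (size (finite M))
  encodedStep i a = encode (finite M) (step M (decode (finite M) i) a)

  decode-foldl-encodedStep : ∀ q w →
    decode (finite M) (foldl encodedStep (encode (finite M) q) w) ≡ foldl (step M) q w
  decode-foldl-encodedStep q []      = decode-encode (finite M) q
  decode-foldl-encodedStep q (a ∷ w) rewrite decode-encode (finite M) q =
    decode-foldl-encodedStep (step M q a) w

  toDFAO : DFAO A Bool
  toDFAO = record
    { nStates = size (finite M)
    ; start   = encode (finite M) (start M)
    ; δ       = encodedStep
    ; out     = accepting M ∘ decode (finite M)
    }

  runDFAO-toDFAO : ∀ w → runDFAO toDFAO w ≡ accepts M w
  runDFAO-toDFAO w = cong (accepting M) (decode-foldl-encodedStep (start M) w)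

fromDFAO : {O : Set} → DFAO A O → (O → Bool) → Automaton A
fromDFAO D o = record
  { State = Fin (DFAO.nStates D) ; finite = finite-Fin ; start = DFAO.start D
  ; step = DFAO.δ D ; accepting = o ∘ DFAO.out D }

module _ (skip? : A → Bool) (M : Automaton A) where
  skippingStep : Bool × State M → A → Bool × State M
  skippingStep (false , q) a = if skip? a then (false , q) else (true , step M q a)
  skippingStep (true  , q) a = true , step M q a

  skipLeading : Automaton A
  skipLeading = record
    { State = Bool × State M ; finite = finite-× finite-Bool (finite M)
    ; start = false , start M ; step = skippingStep ; accepting = accepting M ∘ proj₂ }

  foldl-skippingStep-started : ∀ q w → foldl skippingStep (true , q) w ≡ (true , foldl (step M) q w)
  foldl-skippingStep-started q []      = refl
  foldl-skippingStep-started q (a ∷ w) = foldl-skippingStep-started (step M q a) w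

  foldl-skippingStep : ∀ q w →
    proj₂ (foldl skippingStep (false , q) w) ≡ foldl (step M) q (dropWhileᵇ skip? w)
  foldl-skippingStep q []      = refl
  foldl-skippingStep q (a ∷ w) with skip? a
  ... | true  = foldl-skippingStep q w
  ... | false = cong proj₂ (foldl-skippingStep-started (step M q a) w)

  accepts-skipLeading : ∀ w → accepts skipLeading w ≡ accepts M (dropWhileᵇ skip? w)
  accepts-skipLeading w = cong (accepting M) (foldl-skippingStep (start M) w)

comap : (A → B) → Automaton B → Automaton A
comap f M = record
  { State = State M ; finite = finite M ; start = start M
  ; step = λ q a → step M q (f a) ; accepting = accepting M }

accepts-comap : (f : A → B) (M : Automaton B) → ∀ w → accepts (comap f M) w ≡ accepts M (map f w)
accepts-comap f M w = cong (accepting M) (sym (foldl-map (step M) f (start M) w))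

product : (Bool → Bool → Bool) → Automaton A → Automaton A → Automaton A
product _⊙_ M N = record
  { State = State M × State N ; finite = finite-× (finite M) (finite N)
  ; start = start M , start N
  ; step = λ (p , q) a → step M p a , step N q a
  ; accepting = λ (p , q) → accepting M p ⊙ accepting N q }

accepts-product : (_⊙_ : Bool → Bool → Bool) (M N : Automaton A) →
  ∀ w → accepts (product _⊙_ M N) w ≡ accepts M w ⊙ accepts N w
accepts-product _⊙_ M N w =
  cong (λ (p , q) → accepting M p ⊙ accepting N q) (foldl-product (start M) (start N) w)
  where
  foldl-product : ∀ p q w →
    foldl (step (product _⊙_ M N)) (p , q) w ≡ (foldl (step M) p w , foldl (step N) q w)
  foldl-product p q []      = refl
  foldl-product p q (a ∷ w) = foldl-product (step M p a) (step N q a) w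

complement : Automaton A → Automaton A
complement M = record M { accepting = not ∘ accepting M }

-- Subset construction: a state is the set of (encoded) states of M reachable on zip u c for
-- some word c of the same length as the input u.
module Projection (finC : Finite C) (M : Automaton (A × C)) where
  private
    n : ℕ
    n = size (finite M)

    δ : Fin n → A × C → Fin n
    δ = encodedStep M

    start? : ∀ j → Dec (encode (finite M) (start M) ≡ j)
    start? = encode (finite M) (start M) Fin.≟_

  successor? : ∀ S a j → Dec (∃ λ i → T (lookup S i) × ∃ λ c → δ i (a , c) ≡ j)
  successor? S a j = any? λ i → T? (lookup S i) ×-dec any?-finite finC λ c → δ i (a , c) Fin.≟ j

  successors : Vec Bool n → A → Vec Bool n
  successors S a = tabulate (isYes ∘ successor? S a)

  ReachableFrom : Vec Bool n → List A → Fin n → Set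
  ReachableFrom S u j = ∃ λ i → T (lookup S i) × ∃ λ c → length c ≡ length u × foldl δ i (zip u c) ≡ j

  T-foldl-successors : ∀ S u j → T (lookup (foldl successors S u) j) ⇔ ReachableFrom S u j
  T-foldl-successors S []      j =
    mk⇔ (λ j∈S → j , j∈S , [] , refl , refl) λ { (i , i∈S , [] , _ , refl) → i∈S }
  T-foldl-successors S (a ∷ u) j = ⇔.trans (T-foldl-successors (successors S a) u j) (mk⇔ forward backward)
    where
    forward : ReachableFrom (successors S a) u j → ReachableFrom S (a ∷ u) j
    forward (i′ , i′∈S′ , c , |c| , reach)
      with Equivalence.to (T-lookup-tabulate (successor? S a) i′) i′∈S′
    ... | i , i∈S , d , refl = i , i∈S , d ∷ c , cong suc |c| , reach

    backward : ReachableFrom S (a ∷ u) j → ReachableFrom (successors S a) u j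
    backward (i , i∈S , d ∷ c , |c| , reach) =
      δ i (a , d) , Equivalence.from (T-lookup-tabulate (successor? S a) _) (i , i∈S , d , refl) ,
      c , suc-injective |c| , reach

  project : Automaton A
  project = record
    { State = Vec Bool n ; finite = finite-Vec finite-Bool n
    ; start = tabulate (isYes ∘ start?) ; step = successors
    ; accepting = λ S → isYes (any? λ j → T? (lookup S j) ×-dec T? (accepting M (decode (finite M) j))) }

  accepts-project : ∀ u → T (accepts project u) ⇔ (∃ λ c → length c ≡ length u × T (accepts M (zip u c)))
  accepts-project u = mk⇔ forward backward
    where
    run-encoded : ∀ c → decode (finite M) (foldl δ (encode (finite M) (start M)) (zip u c))
                      ≡ foldl (step M) (start M) (zip u c)
    run-encoded c = decode-foldl-encodedStep M (start M) (zip u c)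

    forward : T (accepts project u) → ∃ λ c → length c ≡ length u × T (accepts M (zip u c))
    forward acc with toWitness acc
    ... | j , j∈S , j-accepting with Equivalence.to (T-foldl-successors _ u j) j∈S
    ... | i , i∈start , c , |c| , refl with Equivalence.to (T-lookup-tabulate start? i) i∈start
    ... | refl = c , |c| , subst (T ∘ accepting M) (run-encoded c) j-accepting

    backward : (∃ λ c → length c ≡ length u × T (accepts M (zip u c))) → T (accepts project u)
    backward (c , |c| , acc) = fromWitness
      ( foldl δ (encode (finite M) (start M)) (zip u c)
      , Equivalence.from (T-foldl-successors _ u _)
          (_ , Equivalence.from (T-lookup-tabulate start? _) refl , c , |c| , refl)
      , subst (T ∘ accepting M) (sym (run-encoded c)) acc )

-- Recognisable predicates

record Recognisable (ev : V → A → V) (v₀ : V) (P : V → Set) : Set₁ where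
  constructor recognised
  field
    automaton : Automaton A
    correct   : ∀ w → T (accepts automaton w) ⇔ P (foldl ev v₀ w)

module _ {ev : V → A → V} {v₀ : V} where
  recognisable-⇔ : {P Q : V → Set} → (∀ v → P v ⇔ Q v) → Recognisable ev v₀ P → Recognisable ev v₀ Q
  recognisable-⇔ P⇔Q (recognised M M-ok) = recognised M λ w → ⇔.trans (M-ok w) (P⇔Q _)

  recognisable-× : {P Q : V → Set} →
    Recognisable ev v₀ P → Recognisable ev v₀ Q → Recognisable ev v₀ (λ v → P v × Q v)
  recognisable-× (recognised M M-ok) (recognised N N-ok) = recognised (product _∧_ M N) λ w →
    subst (λ b → T b ⇔ _) (sym (accepts-product _∧_ M N w)) (⇔.trans T-∧ (M-ok w ×-⇔ N-ok w))

  recognisable-⊎ : {P Q : V → Set} →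
    Recognisable ev v₀ P → Recognisable ev v₀ Q → Recognisable ev v₀ (λ v → P v ⊎ Q v)
  recognisable-⊎ (recognised M M-ok) (recognised N N-ok) = recognised (product _∨_ M N) λ w →
    subst (λ b → T b ⇔ _) (sym (accepts-product _∨_ M N w)) (⇔.trans T-∨ (M-ok w ⊎-⇔ N-ok w))

  recognisable-¬ : {P : V → Set} → Recognisable ev v₀ P → Recognisable ev v₀ (¬_ ∘ P)
  recognisable-¬ (recognised M M-ok) = recognised (complement M) λ w → ⇔.trans T-not (¬-cong-⇔ (M-ok w))
    where
    T-not : ∀ {b} → T (not b) ⇔ (¬ T b)
    T-not {false} = mk⇔ (λ _ ()) _
    T-not {true}  = mk⇔ (λ ()) (λ ¬⊤ → ¬⊤ _)

  recognisable-invariant : {P : V → Set} (M : Automaton A) (I : State M → V → Set) →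
    I (start M) v₀ → (∀ q v a → I q v → I (step M q a) (ev v a)) →
    (∀ q v → I q v → T (accepting M q) ⇔ P v) → Recognisable ev v₀ P
  recognisable-invariant M I I-start I-step I-accepting =
    recognised M λ w → I-accepting _ _ (preserved w (start M) v₀ I-start)
    where
    preserved : ∀ w q v → I q v → I (foldl (step M) q w) (foldl ev v w)
    preserved []      q v i = i
    preserved (a ∷ w) q v i = preserved w (step M q a) (ev v a) (I-step q v a i)

recognisable-comap : {evA : V → A → V} {evB : W → B → W} {v₀ : V} {w₀ : W} {P : W → Set}
  (f : A → B) (g : V → W) → g v₀ ≡ w₀ → (∀ v a → g (evA v a) ≡ evB (g v) (f a)) →
  Recognisable evB w₀ P → Recognisable evA v₀ (P ∘ g)
recognisable-comap {v₀ = v₀} {P = P} f g refl g-ev (recognised M M-ok) = recognised (comap f M) λ w →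
  subst₂ (λ b v → T b ⇔ P v) (sym (accepts-comap f M w)) (sym (foldl-natural f g g-ev v₀ w)) (M-ok (map f w))

recognisable-∃ : {ev : V → A → V} {evC : W → C → W} {v₀ : V} {c₀ : W} {P : V → W → Set} →
  Finite C →
  (∀ u x → P (foldl ev v₀ u) x → ∃ λ c → length c ≡ length u × foldl evC c₀ c ≡ x) →
  Recognisable (ev ⊗ evC) (v₀ , c₀) (uncurry P) → Recognisable ev v₀ (λ v → ∃ (P v))
recognisable-∃ {ev = ev} {evC} {v₀} {c₀} {P} finC witness (recognised M M-ok) =
  recognised (Projection.project finC M) λ u →
    ⇔.trans (Projection.accepts-project finC M u) (mk⇔ (forward u) (backward u))
  where
  values : ∀ u c → length c ≡ length u →
    foldl (ev ⊗ evC) (v₀ , c₀) (zip u c) ≡ (foldl ev v₀ u , foldl evC c₀ c)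
  values u c |c| = foldl-⊗-zip ev evC v₀ c₀ u c (sym |c|)

  forward : ∀ u → (∃ λ c → length c ≡ length u × T (accepts M (zip u c))) → ∃ (P (foldl ev v₀ u))
  forward u (c , |c| , acc) =
    foldl evC c₀ c , subst (uncurry P) (values u c |c|) (Equivalence.to (M-ok (zip u c)) acc)

  backward : ∀ u → ∃ (P (foldl ev v₀ u)) → ∃ λ c → length c ≡ length u × T (accepts M (zip u c))
  backward u (x , p) with witness u x p
  ... | c , |c| , refl =
    c , |c| , Equivalence.from (M-ok (zip u c)) (subst (uncurry P) (sym (values u c |c|)) p)

AtPredecessor : (V → ℕ → Set) → V → ℕ → Set
AtPredecessor R v y = ∃ λ y′ → y ≡ suc y′ × R v y′

-- Base-k numerals, most significant digit first

module Numerals (k₀ : ℕ) where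
  k : ℕ
  k = suc k₀

  Digit : Set
  Digit = Fin k

  pushDigit : ℕ → Digit → ℕ
  pushDigit x d = toℕ d + x * k

  val : List Digit → ℕ
  val = foldl pushDigit 0

  val₂ : List (Digit × Digit) → ℕ × ℕ
  val₂ = foldl (pushDigit ⊗ pushDigit) (0 , 0)

  Recognisable₁ : (ℕ → Set) → Set₁
  Recognisable₁ = Recognisable pushDigit 0

  Recognisable₂ : (ℕ → ℕ → Set) → Set₁
  Recognisable₂ R = Recognisable (pushDigit ⊗ pushDigit) (0 , 0) (uncurry R)

  Recognisable₃ : (ℕ → ℕ → ℕ → Set) → Set₁
  Recognisable₃ R = Recognisable ((pushDigit ⊗ pushDigit) ⊗ pushDigit) ((0 , 0) , 0) λ ((x , y) , z) → R x y z

  on₁ : {P : ℕ → Set} → Recognisable₁ P → Recognisable₂ λ x _ → P x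
  on₁ {P} = recognisable-comap {P = P} proj₁ proj₁ refl (λ _ _ → refl)

  on₂ : {P : ℕ → Set} → Recognisable₁ P → Recognisable₂ λ _ y → P y
  on₂ {P} = recognisable-comap {P = P} proj₂ proj₂ refl (λ _ _ → refl)

  swapped : {R : ℕ → ℕ → Set} → Recognisable₂ R → Recognisable₂ (flip R)
  swapped {R} = recognisable-comap {P = uncurry R} swap swap refl (λ _ _ → refl)

  foldl-pushDigit-< : ∀ x w → foldl pushDigit x w < suc x * k ^ length w
  foldl-pushDigit-< x []      = ≤-reflexive (sym (*-identityʳ (suc x)))
  foldl-pushDigit-< x (d ∷ w) = begin-strict
    foldl pushDigit (pushDigit x d) w   <⟨ foldl-pushDigit-< (pushDigit x d) w ⟩
    suc (pushDigit x d) * k ^ length w  ≤⟨ *-monoˡ-≤ (k ^ length w) (+-monoˡ-≤ (x * k) (toℕ<n d)) ⟩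
    (k + x * k) * k ^ length w          ≡⟨ *-assoc (suc x) k (k ^ length w) ⟩
    suc x * k ^ length (d ∷ w)          ∎
    where open ≤-Reasoning

  foldl-pushDigit-≥ : ∀ x w → x * k ^ length w ≤ foldl pushDigit x w
  foldl-pushDigit-≥ x []      = ≤-reflexive (*-identityʳ x)
  foldl-pushDigit-≥ x (d ∷ w) = begin
    x * k ^ length (d ∷ w)             ≡⟨ *-assoc x k (k ^ length w) ⟨
    x * k * k ^ length w               ≤⟨ *-monoˡ-≤ (k ^ length w) (m≤n+m (x * k) (toℕ d)) ⟩
    pushDigit x d * k ^ length w       ≤⟨ foldl-pushDigit-≥ (pushDigit x d) w ⟩
    foldl pushDigit (pushDigit x d) w  ∎
    where open ≤-Reasoning

  foldl-pushDigit-suc-≥ : ∀ x w → k ^ length w ≤ foldl pushDigit (suc x) w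
  foldl-pushDigit-suc-≥ x w = ≤-trans (m≤m+n (k ^ length w) (x * k ^ length w)) (foldl-pushDigit-≥ (suc x) w)

  val<k^length : ∀ w → val w < k ^ length w
  val<k^length w = ≤-trans (foldl-pushDigit-< 0 w) (≤-reflexive (+-identityʳ (k ^ length w)))

  k^m≤x<k^n⇒m<n : ∀ {m n x} → k ^ m ≤ x → x < k ^ n → m < n
  k^m≤x<k^n⇒m<n k^m≤x x<k^n = ≰⇒> λ n≤m → <⇒≱ (≤-<-trans k^m≤x x<k^n) (^-monoʳ-≤ k n≤m)

  pushDigit-injective : JointlyInjective pushDigit
  pushDigit-injective {x} {y} {d} {e} eq = x≡y , toℕ-injective d≡e
    where
    d≡e : toℕ d ≡ toℕ e
    d≡e = begin
      toℕ d              ≡⟨ m<n⇒m%n≡m (toℕ<n d) ⟨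
      toℕ d % k          ≡⟨ [m+kn]%n≡m%n (toℕ d) x k ⟨
      pushDigit x d % k  ≡⟨ cong (_% k) eq ⟩
      pushDigit y e % k  ≡⟨ [m+kn]%n≡m%n (toℕ e) y k ⟩
      toℕ e % k          ≡⟨ m<n⇒m%n≡m (toℕ<n e) ⟩
      toℕ e              ∎
      where open ≡-Reasoning

    x≡y : x ≡ y
    x≡y = *-cancelʳ-≡ x y k (+-cancelˡ-≡ (toℕ d) (x * k) (y * k) (trans eq (cong (_+ y * k) (sym d≡e))))

  word-of-value : ∀ L z → z < k ^ L → ∃ λ w → length w ≡ L × val w ≡ z
  word-of-value zero    z z<1 = [] , refl , sym (n<1⇒n≡0 z<1)
  word-of-value (suc L) z z<k^1+L
    with word-of-value L (z / k) (m<n*o⇒m/o<n (subst (z <_) (*-comm k (k ^ L)) z<k^1+L))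
  ... | w , refl , val-w = w ∷ʳ (z mod k) , trans (length-++ w) (+-comm L 1) , (begin
    val (w ∷ʳ (z mod k))         ≡⟨ foldl-∷ʳ pushDigit 0 (z mod k) w ⟩
    pushDigit (val w) (z mod k)  ≡⟨ cong₂ _+_ (toℕ-fromℕ< (m%n<n z k)) (cong (_* k) val-w) ⟩
    z % k + z / k * k            ≡⟨ m≡m%n+[m/n]*n z k ⟨
    z                            ∎)
    where open ≡-Reasoning

  proj₁-foldl-⊗ : ∀ x y p →
    proj₁ (foldl (pushDigit ⊗ pushDigit) (x , y) p) ≡ foldl pushDigit x (map proj₁ p)
  proj₁-foldl-⊗ x y = foldl-natural proj₁ proj₁ (λ _ _ → refl) (x , y)

  proj₂-foldl-⊗ : ∀ x y p →
    proj₂ (foldl (pushDigit ⊗ pushDigit) (x , y) p) ≡ foldl pushDigit y (map proj₂ p)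
  proj₂-foldl-⊗ x y = foldl-natural proj₂ proj₂ (λ _ _ → refl) (x , y)

  Fits₁ : ℕ → ℕ → Set
  Fits₁ L x = x < k ^ L

  Fits₂ : ℕ → ℕ × ℕ → Set
  Fits₂ L (x , y) = x < k ^ L × y < k ^ L

  Shortest₁ : List Digit → Set
  Shortest₁ = Shortest {ev = pushDigit} {v₀ = 0} Fits₁

  Shortest₂ : List (Digit × Digit) → Set
  Shortest₂ = Shortest {ev = pushDigit ⊗ pushDigit} {v₀ = 0 , 0} Fits₂

  fits₂ : ∀ p → Fits₂ (length p) (val₂ p)
  fits₂ p = subst (_< k ^ length p) (sym (proj₁-foldl-⊗ 0 0 p)) (fits proj₁)
          , subst (_< k ^ length p) (sym (proj₂-foldl-⊗ 0 0 p)) (fits proj₂)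
    where
    fits : ∀ (π : Digit × Digit → Digit) → val (map π p) < k ^ length p
    fits π = subst (λ L → val (map π p) < k ^ L) (length-map π p) (val<k^length (map π p))

  shortest₁-unique : ∀ {u u′} → Shortest₁ u → Shortest₁ u′ → val u ≡ val u′ → u ≡ u′
  shortest₁-unique = shortest-unique Fits₁ val<k^length pushDigit-injective

  shortest₂-unique : ∀ {p p′} → Shortest₂ p → Shortest₂ p′ → val₂ p ≡ val₂ p′ → p ≡ p′
  shortest₂-unique = shortest-unique Fits₂ fits₂ (⊗-injective pushDigit-injective pushDigit-injective)

  shortest₂-leading : ∀ {x L} (π : Digit × Digit → Digit) p →
    foldl pushDigit (suc x) (map π p) < k ^ L → suc (length p) ≤ L
  shortest₂-leading {x} π p fits =
    subst (λ n → suc n ≤ _) (length-map π p) (k^m≤x<k^n⇒m<n (foldl-pushDigit-suc-≥ x (map π p)) fits)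

  isZero : Digit → Bool
  isZero Fin.zero    = true
  isZero (Fin.suc _) = false

  isZero₂ : Digit × Digit → Bool
  isZero₂ (d , e) = isZero d ∧ isZero e

  dropZeros : List Digit → List Digit
  dropZeros = dropWhileᵇ isZero

  dropZeros₂ : List (Digit × Digit) → List (Digit × Digit)
  dropZeros₂ = dropWhileᵇ isZero₂

  val-dropZeros : ∀ w → val (dropZeros w) ≡ val w
  val-dropZeros []              = refl
  val-dropZeros (Fin.zero  ∷ w) = val-dropZeros w
  val-dropZeros (Fin.suc _ ∷ w) = refl

  shortest-dropZeros : ∀ w → Shortest₁ (dropZeros w)
  shortest-dropZeros []              _    = z≤n
  shortest-dropZeros (Fin.zero  ∷ w)      = shortest-dropZeros w
  shortest-dropZeros (Fin.suc d ∷ w) fits = k^m≤x<k^n⇒m<n (foldl-pushDigit-suc-≥ (toℕ d + 0) w) fits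

  val₂-dropZeros₂ : ∀ p → val₂ (dropZeros₂ p) ≡ val₂ p
  val₂-dropZeros₂ []                            = refl
  val₂-dropZeros₂ ((Fin.zero  , Fin.zero)  ∷ p) = val₂-dropZeros₂ p
  val₂-dropZeros₂ ((Fin.zero  , Fin.suc _) ∷ p) = refl
  val₂-dropZeros₂ ((Fin.suc _ , _)         ∷ p) = refl

  shortest-dropZeros₂ : ∀ p → Shortest₂ (dropZeros₂ p)
  shortest-dropZeros₂ []                            _          = z≤n
  shortest-dropZeros₂ ((Fin.zero  , Fin.zero)  ∷ p)            = shortest-dropZeros₂ p
  shortest-dropZeros₂ ((Fin.zero  , Fin.suc e) ∷ p) (_ , fits) =
    shortest₂-leading proj₂ p (subst (_< _) (proj₂-foldl-⊗ 0 _ p) fits)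
  shortest-dropZeros₂ ((Fin.suc d , e)         ∷ p) (fits , _) =
    shortest₂-leading proj₁ p (subst (_< _) (proj₁-foldl-⊗ _ _ p) fits)

  recognisable-≡0 : Recognisable₁ (_≡ 0)
  recognisable-≡0 = recognisable-invariant zeroTest (λ b x → b ≡ (x ≡ᵇ 0)) refl
    (λ { b x d refl → sym (pushDigit≡ᵇ0 x d) }) (λ { b x refl → mk⇔ (≡ᵇ⇒≡ x 0) (≡⇒≡ᵇ x 0) })
    where
    zeroTest : Automaton Digit
    zeroTest = record
      { State = Bool ; finite = finite-Bool ; start = true
      ; step = λ b d → isZero d ∧ b ; accepting = id }

    pushDigit≡ᵇ0 : ∀ x d → (pushDigit x d ≡ᵇ 0) ≡ isZero d ∧ (x ≡ᵇ 0)
    pushDigit≡ᵇ0 zero    Fin.zero    = refl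
    pushDigit≡ᵇ0 (suc x) Fin.zero    = refl
    pushDigit≡ᵇ0 x       (Fin.suc d) = refl

  Compares : Comparison → ℕ × ℕ → Set
  Compares less    (x , y) = x < y
  Compares equal   (x , y) = x ≡ y
  Compares greater (x , y) = y < x

  compareDigits : Digit → Digit → Comparison
  compareDigits d e with <-cmp (toℕ d) (toℕ e)
  ... | tri< _ _ _ = less
  ... | tri≈ _ _ _ = equal
  ... | tri> _ _ _ = greater

  compares-compareDigits : ∀ x d e → Compares (compareDigits d e) (pushDigit x d , pushDigit x e)
  compares-compareDigits x d e with <-cmp (toℕ d) (toℕ e)
  ... | tri< d<e _   _   = +-monoˡ-< (x * k) d<e
  ... | tri≈ _   d≡e _   = cong (_+ x * k) d≡e
  ... | tri> _   _   e<d = +-monoˡ-< (x * k) e<d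

  pushDigit-mono-< : ∀ {x y} d e → x < y → pushDigit x d < pushDigit y e
  pushDigit-mono-< {x} {y} d e x<y = begin-strict
    toℕ d + x * k  <⟨ +-monoˡ-< (x * k) (toℕ<n d) ⟩
    k + x * k      ≤⟨ *-monoˡ-≤ k x<y ⟩
    y * k          ≤⟨ m≤n+m (y * k) (toℕ e) ⟩
    toℕ e + y * k  ∎
    where open ≤-Reasoning

  recognisable-≤ : Recognisable₂ _≤_
  recognisable-≤ = recognisable-invariant comparator Compares refl compares-step accepting-≤
    where
    compareStep : Comparison → Digit × Digit → Comparison
    compareStep equal (d , e) = compareDigits d e
    compareStep c     _       = c

    comparator : Automaton (Digit × Digit)
    comparator = record
      { State = Comparison ; finite = finite-Comparison ; start = equal ; step = compareStep
      ; accepting = λ { greater → false ; _ → true } }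

    compares-step : ∀ c v a → Compares c v → Compares (compareStep c a) ((pushDigit ⊗ pushDigit) v a)
    compares-step less    (x , y)  (d , e) x<y  = pushDigit-mono-< d e x<y
    compares-step equal   (x , .x) (d , e) refl = compares-compareDigits x d e
    compares-step greater (x , y)  (d , e) y<x  = pushDigit-mono-< e d y<x

    accepting-≤ : ∀ c v → Compares c v → T (accepting comparator c) ⇔ uncurry _≤_ v
    accepting-≤ less    _ x<y  = mk⇔ (λ _ → <⇒≤ x<y) _
    accepting-≤ equal   _ refl = mk⇔ (λ _ → ≤-refl) _
    accepting-≤ greater _ y<x  = mk⇔ (λ ()) (<⇒≱ y<x)

  -- Runs M on (v , y) and, once y > 0, on (v , y - 1): after a digit e > 0 the word of y - 1 is
  -- the prefix of y followed by e - 1, after a digit 0 it borrows, as y k - 1 = (y - 1) k + (k - 1).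
  module Predecessor {ev : V → A → V} {v₀ : V} (M : Automaton (A × Digit)) where
    Reaches : State M → V × ℕ → Set
    Reaches q u = ∃ λ w → foldl (ev ⊗ pushDigit) (v₀ , 0) w ≡ u × foldl (step M) (start M) w ≡ q

    reaches-step : ∀ {q u} a → Reaches q u → Reaches (step M q a) ((ev ⊗ pushDigit) u a)
    reaches-step a (w , refl , refl) = w ∷ʳ a , foldl-∷ʳ _ _ a w , foldl-∷ʳ _ _ a w

    borrowStep : State M × State M × Bool → A × Digit → State M × State M × Bool
    borrowStep (q , q⁻ , positive) (a , Fin.zero)  =
      step M q (a , Fin.zero) , step M q⁻ (a , Fin.fromℕ k₀) , positive
    borrowStep (q , q⁻ , positive) (a , Fin.suc e) =
      step M q (a , Fin.suc e) , step M q (a , Fin.inject₁ e) , true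

    decrement : Automaton (A × Digit)
    decrement = record
      { State = State M × State M × Bool ; finite = finite-× (finite M) (finite-× (finite M) finite-Bool)
      ; start = start M , start M , false ; step = borrowStep
      ; accepting = λ (_ , q⁻ , positive) → positive ∧ accepting M q⁻ }

    Borrow : State M → Bool → V × ℕ → Set
    Borrow q⁻ false (v , y) = y ≡ 0
    Borrow q⁻ true  (v , y) = AtPredecessor (λ v y′ → Reaches q⁻ (v , y′)) v y

    Invariant : State M × State M × Bool → V × ℕ → Set
    Invariant (q , q⁻ , positive) u = Reaches q u × Borrow q⁻ positive u

    invariant-step : ∀ s u a → Invariant s u → Invariant (borrowStep s a) ((ev ⊗ pushDigit) u a)
    invariant-step (q , q⁻ , false) (v , y) (a , Fin.zero) (r , refl) = reaches-step _ r , refl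
    invariant-step (q , q⁻ , true) (v , _) (a , Fin.zero) (r , y′ , refl , r⁻) =
      reaches-step _ r ,
      pushDigit y′ (Fin.fromℕ k₀) , cong (λ n → suc (n + y′ * k)) (sym (toℕ-fromℕ k₀)) ,
      reaches-step _ r⁻
    invariant-step (q , q⁻ , positive) (v , y) (a , Fin.suc e) (r , _) =
      reaches-step _ r ,
      pushDigit y (Fin.inject₁ e) , cong (λ n → suc (n + y * k)) (sym (toℕ-inject₁ e)) , reaches-step _ r

    module _ {R : V → ℕ → Set}
             (M-ok : ∀ w → T (accepts M w) ⇔ uncurry R (foldl (ev ⊗ pushDigit) (v₀ , 0) w)) where
      reaches-accepting : ∀ {q u} → Reaches q u → T (accepting M q) ⇔ uncurry R u
      reaches-accepting (w , refl , refl) = M-ok w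

      invariant-accepting : ∀ s u → Invariant s u → T (accepting decrement s) ⇔ uncurry (AtPredecessor R) u
      invariant-accepting (q , q⁻ , false) (v , y) (_ , refl) = mk⇔ (λ ()) λ { (_ , () , _) }
      invariant-accepting (q , q⁻ , true)  (v , y) (_ , y′ , refl , r⁻) =
        mk⇔ (λ acc → y′ , refl , Equivalence.to (reaches-accepting r⁻) acc)
            (λ { (_ , refl , Ry′) → Equivalence.from (reaches-accepting r⁻) Ry′ })

  recognisable-predecessor : {ev : V → A → V} {v₀ : V} {R : V → ℕ → Set} →
    Recognisable (ev ⊗ pushDigit) (v₀ , 0) (uncurry R) →
    Recognisable (ev ⊗ pushDigit) (v₀ , 0) (uncurry (AtPredecessor R))
  recognisable-predecessor {R = R} (recognised M M-ok) =
    recognisable-invariant decrement Invariant (([] , refl , refl) , refl) invariant-step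
      (invariant-accepting {R = R} M-ok)
    where open Predecessor M

  recognisable-∃≤ : {R : ℕ → ℕ → ℕ → Set} →
    Recognisable₃ (λ x y z → z ≤ x × R x y z) → Recognisable₂ λ x y → ∃ λ z → z ≤ x × R x y z
  recognisable-∃≤ {R} =
    recognisable-∃ {ev = pushDigit ⊗ pushDigit} {evC = pushDigit} {v₀ = 0 , 0} {c₀ = 0}
                   {P = λ (x , y) z → z ≤ x × R x y z} finite-Fin
      λ u z (z≤x , _) → word-of-value (length u) z (≤-<-trans z≤x (proj₁ (fits₂ u)))

module Representation (k₁ : ℕ) where
  open Numerals (suc k₁) public

  valLSD : List Digit → ℕ
  valLSD = foldr (flip pushDigit) 0

  valLSD-digitsLSD : ∀ f n → n ≤ f → valLSD (digitsLSD k f n) ≡ n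
  valLSD-digitsLSD zero    zero z≤n = refl
  valLSD-digitsLSD (suc f) n    n≤f with n ≟ 0
  ... | yes refl = refl
  ... | no  n≢0  = begin
    toℕ (n mod k) + valLSD (digitsLSD k f (n / k)) * k
      ≡⟨ cong₂ _+_ (toℕ-fromℕ< (m%n<n n k)) (cong (_* k) IH) ⟩
    n % k + n / k * k
      ≡⟨ m≡m%n+[m/n]*n n k ⟨
    n ∎
    where
    open ≡-Reasoning
    n/k<n : n / k < n
    n/k<n = m/n<m n k {{≢-nonZero n≢0}} (s≤s (s≤s z≤n))

    IH : valLSD (digitsLSD k f (n / k)) ≡ n / k
    IH = valLSD-digitsLSD f (n / k) (s≤s⁻¹ (≤-trans n/k<n n≤f))

  length-digitsLSD : ∀ f n L → n < k ^ L → length (digitsLSD k f n) ≤ L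
  length-digitsLSD zero    n L       _     = z≤n
  length-digitsLSD (suc f) n L       n<k^L with n ≟ 0
  ... | yes _ = z≤n
  length-digitsLSD (suc f) n zero    n<1     | no n≢0 = contradiction (n<1⇒n≡0 n<1) n≢0
  length-digitsLSD (suc f) n (suc L) n<k^1+L | no n≢0 =
    s≤s (length-digitsLSD f (n / k) L (m<n*o⇒m/o<n (subst (n <_) (*-comm k (k ^ L)) n<k^1+L)))

  val-rep : ∀ n → val (rep k n) ≡ n
  val-rep n = trans (reverse-foldl pushDigit 0 (digitsLSD k n n)) (valLSD-digitsLSD n n ≤-refl)

  shortest-rep : ∀ n → Shortest₁ (rep k n)
  shortest-rep n {L} fits = subst (_≤ L) (sym (length-reverse (digitsLSD k n n)))
    (length-digitsLSD n n L (subst (_< k ^ L) (val-rep n) fits))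

  dropZeros-rep : ∀ w → dropZeros w ≡ rep k (val w)
  dropZeros-rep w = shortest₁-unique (shortest-dropZeros w) (shortest-rep (val w))
    (trans (val-dropZeros w) (sym (val-rep (val w))))

  val-padTo : ∀ L u → val (padTo k L u) ≡ val u
  val-padTo L u = trans (foldl-++ pushDigit 0 (replicate (L ∸ length u) (0 mod k)) u)
                        (cong (λ x → foldl pushDigit x u) (val-zeros (L ∸ length u)))
    where
    val-zeros : ∀ j → val (replicate j (0 mod k)) ≡ 0
    val-zeros zero    = refl
    val-zeros (suc j) = val-zeros j

  length-padTo : ∀ L u → length u ≤ L → length (padTo k L u) ≡ L
  length-padTo L u |u|≤L = begin
    length (zeros ++ u)      ≡⟨ length-++ zeros ⟩
    length zeros + length u  ≡⟨ cong (_+ length u) (length-replicate (L ∸ length u)) ⟩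
    L ∸ length u + length u  ≡⟨ m∸n+n≡m |u|≤L ⟩
    L                        ∎
    where
    open ≡-Reasoning
    zeros : List Digit
    zeros = replicate (L ∸ length u) (0 mod k)

  module _ (n m : ℕ) where
    private
      L : ℕ
      L = length (rep k n) ⊔ length (rep k m)

      |pad-n| : length (padTo k L (rep k n)) ≡ L
      |pad-n| = length-padTo L (rep k n) (m≤m⊔n _ _)

      |pad-m| : length (padTo k L (rep k m)) ≡ L
      |pad-m| = length-padTo L (rep k m) (m≤n⊔m _ _)

    val₂-pairRep : val₂ (pairRep k n m) ≡ (n , m)
    val₂-pairRep =
      trans (foldl-⊗-zip pushDigit pushDigit 0 0 (padTo k L (rep k n)) (padTo k L (rep k m))
                         (trans |pad-n| (sym |pad-m|)))
            (cong₂ _,_ (trans (val-padTo L (rep k n)) (val-rep n)) (trans (val-padTo L (rep k m)) (val-rep m)))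

    length-pairRep : length (pairRep k n m) ≡ L
    length-pairRep = trans (length-zipWith _,_ (padTo k L (rep k n)) (padTo k L (rep k m)))
                           (trans (cong₂ _⊓_ |pad-n| |pad-m|) (⊓-idem L))

    shortest-pairRep : Shortest₂ (pairRep k n m)
    shortest-pairRep {L′} fits with subst (Fits₂ L′) val₂-pairRep fits
    ... | n-fits , m-fits = subst (_≤ L′) (sym length-pairRep)
      (⊔-lub (shortest-rep n (subst (_< k ^ L′) (sym (val-rep n)) n-fits))
             (shortest-rep m (subst (_< k ^ L′) (sym (val-rep m)) m-fits)))

  dropZeros₂-pairRep : ∀ p → dropZeros₂ p ≡ pairRep k (proj₁ (val₂ p)) (proj₂ (val₂ p))
  dropZeros₂-pairRep p = shortest₂-unique (shortest-dropZeros₂ p) (shortest-pairRep n m)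
    (trans (val₂-dropZeros₂ p) (sym (val₂-pairRep n m)))
    where
    n m : ℕ
    n = proj₁ (val₂ p)
    m = proj₂ (val₂ p)

  recognisable-automatic : (s : ℕ → Fin 2) → Automatic k s → Recognisable₁ (λ x → toℕ (s x) ≡ 1)
  recognisable-automatic s (D , D-ok) =
    recognised reader λ w → subst (λ b → T b ⇔ toℕ (s (val w)) ≡ 1) (sym (accepted w)) (T-isOne (s (val w)))
    where
    isOne : Fin 2 → Bool
    isOne Fin.zero    = false
    isOne (Fin.suc _) = true

    T-isOne : ∀ b → T (isOne b) ⇔ toℕ b ≡ 1
    T-isOne Fin.zero           = mk⇔ (λ ()) (λ ())
    T-isOne (Fin.suc Fin.zero) = mk⇔ (λ _ → refl) _

    reader : Automaton Digit
    reader = skipLeading isZero (fromDFAO D isOne)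

    accepted : ∀ w → accepts reader w ≡ isOne (s (val w))
    accepted w = begin
      accepts reader w                   ≡⟨ accepts-skipLeading isZero (fromDFAO D isOne) w ⟩
      isOne (runDFAO D (dropZeros w))    ≡⟨ cong (isOne ∘ runDFAO D) (dropZeros-rep w) ⟩
      isOne (runDFAO D (rep k (val w)))  ≡⟨ cong isOne (D-ok (val w)) ⟩
      isOne (s (val w))                  ∎
      where open ≡-Reasoning

  synchronised⇔recognisable₂ : (G : ℕ → ℕ → Set) → Synchronised k G ⇔ Recognisable₂ G
  synchronised⇔recognisable₂ G = mk⇔ recognise synchronise
    where
    recognise : Synchronised k G → Recognisable₂ G
    recognise (D , D-ok) = recognised reader λ p →
      subst (λ b → T b ⇔ uncurry G (val₂ p)) (sym (accepted p)) (⇔.trans T-≡ (D-ok _ _))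
      where
      reader : Automaton (Digit × Digit)
      reader = skipLeading isZero₂ (fromDFAO D id)

      accepted : ∀ p → accepts reader p ≡ runDFAO D (pairRep k (proj₁ (val₂ p)) (proj₂ (val₂ p)))
      accepted p = trans (accepts-skipLeading isZero₂ (fromDFAO D id) p) (cong (runDFAO D) (dropZeros₂-pairRep p))

    synchronise : Recognisable₂ G → Synchronised k G
    synchronise (recognised M M-ok) = toDFAO M , λ n m →
      subst₂ (λ b v → (b ≡ true) ⇔ uncurry G v) (sym (runDFAO-toDFAO M (pairRep k n m))) (val₂-pairRep n m)
        (⇔.trans (⇔.sym T-≡) (M-ok (pairRep k n m)))

-- Counting the ones of s

module Counting (s : ℕ → Fin 2) where
  sumSeq≡onesBelow : ∀ n → sumSeq s n ≡ onesBelow s (suc n)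
  sumSeq≡onesBelow zero    = refl
  sumSeq≡onesBelow (suc n) = cong (_+ toℕ (s (suc n))) (sumSeq≡onesBelow n)

  onesBelow-mono : ∀ {i j} → i ≤ j → onesBelow s i ≤ onesBelow s j
  onesBelow-mono {j = zero}  z≤n   = ≤-refl
  onesBelow-mono {i} {suc j} i≤1+j with m≤n⇒m<n∨m≡n i≤1+j
  ... | inj₁ i<1+j = ≤-trans (onesBelow-mono (s≤s⁻¹ i<1+j)) (m≤m+n (onesBelow s j) _)
  ... | inj₂ refl  = ≤-refl

  <onesBelow⇒IndGraph : ∀ N m → m < onesBelow s N → ∃ λ z → z < N × IndGraph s m z
  <onesBelow⇒IndGraph (suc N) m m<ones with m <? onesBelow s N
  ... | yes m<ones′ with <onesBelow⇒IndGraph N m m<ones′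
  ...   | z , z<N , ind = z , m<n⇒m<1+n z<N , ind
  <onesBelow⇒IndGraph (suc N) m m<ones | no m≮ones with s N in s[N]≡
  ...   | Fin.zero         = contradiction (subst (m <_) (+-identityʳ _) m<ones) m≮ones
  ...   | Fin.suc Fin.zero = N , ≤-refl , cong toℕ s[N]≡ ,
                             ≤-antisym (≮⇒≥ m≮ones) (s≤s⁻¹ (subst (m <_) (+-comm _ 1) m<ones))

  onesBelow≡⇔ : ∀ n m → onesBelow s m ≡ n ⇔ ((n ≡ 0 × m ≡ 0) ⊎ AtPredecessor (flip (SumGraph s)) n m)
  onesBelow≡⇔ n zero    =
    mk⇔ (λ 0≡n → inj₁ (sym 0≡n , refl)) λ { (inj₁ (refl , _)) → refl ; (inj₂ (_ , () , _)) }
  onesBelow≡⇔ n (suc m) =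
    mk⇔ (λ ones≡n → inj₂ (m , refl , trans (sym ones≡n) (sym (sumSeq≡onesBelow m))))
        λ { (inj₁ (_ , ())) ; (inj₂ (_ , refl , n≡sum)) → sym (trans n≡sum (sumSeq≡onesBelow m)) }

  indGraph⇔ : ∀ n m →
    IndGraph s n m ⇔ (toℕ (s m) ≡ 1 × ((n ≡ 0 × m ≡ 0) ⊎ AtPredecessor (flip (SumGraph s)) n m))
  indGraph⇔ n m = mk⇔ id id ×-⇔ onesBelow≡⇔ n m

  IndAtMost : ℕ → ℕ → Set
  IndAtMost n m = ∃ λ z → z ≤ n × IndGraph s m z

  indAtMost⇔<sumSeq : ∀ n m → IndAtMost n m ⇔ m < sumSeq s n
  indAtMost⇔<sumSeq n m = mk⇔ to from
    where
    to : IndAtMost n m → m < sumSeq s n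
    to (z , z≤bound , s[z]≡1 , refl) = begin-strict
      onesBelow s z              <⟨ m<m+n (onesBelow s z) (subst (0 <_) (sym s[z]≡1) z<s) ⟩
      onesBelow s z + toℕ (s z)  ≤⟨ onesBelow-mono (s≤s z≤bound) ⟩
      onesBelow s (suc n)        ≡⟨ sumSeq≡onesBelow n ⟨
      sumSeq s n                 ∎
      where open ≤-Reasoning

    from : m < sumSeq s n → IndAtMost n m
    from m<sum with <onesBelow⇒IndGraph (suc n) m (subst (m <_) (sumSeq≡onesBelow n) m<sum)
    ... | z , z<1+n , ind = z , s≤s⁻¹ z<1+n , ind

  sumGraph⇔ : ∀ n m → SumGraph s n m ⇔ (¬ IndAtMost n m × (m ≡ 0 ⊎ AtPredecessor IndAtMost n m))
  sumGraph⇔ n m = mk⇔ (to m) (from m)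
    where
    below : ∀ m → IndAtMost n m ⇔ m < sumSeq s n
    below = indAtMost⇔<sumSeq n

    to : ∀ m → m ≡ sumSeq s n → ¬ IndAtMost n m × (m ≡ 0 ⊎ AtPredecessor IndAtMost n m)
    to zero    m≡sum = (λ ind → <-irrefl m≡sum (Equivalence.to (below 0) ind)) , inj₁ refl
    to (suc m) m≡sum = (λ ind → <-irrefl m≡sum (Equivalence.to (below (suc m)) ind))
                     , inj₂ (m , refl , Equivalence.from (below m) (subst (m <_) m≡sum ≤-refl))

    from : ∀ m → ¬ IndAtMost n m × (m ≡ 0 ⊎ AtPredecessor IndAtMost n m) → m ≡ sumSeq s n
    from m (¬ind , pred) = ≤-antisym (upper pred) (≮⇒≥ (¬ind ∘ Equivalence.from (below m)))
      where
      upper : m ≡ 0 ⊎ AtPredecessor IndAtMost n m → m ≤ sumSeq s n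
      upper (inj₁ refl)              = z≤n
      upper (inj₂ (m′ , refl , ind)) = Equivalence.to (below m′) ind

module _ (k₁ : ℕ) (s : ℕ → Fin 2) (s-automatic : Automatic (suc (suc k₁)) s) where
  open Representation k₁
  open Counting s

  private
    s≡1 : Recognisable₁ λ x → toℕ (s x) ≡ 1
    s≡1 = recognisable-automatic s s-automatic

    recognisable⇒synchronised : {G : ℕ → ℕ → Set} → Recognisable₂ G → Synchronised k G
    recognisable⇒synchronised {G} = Equivalence.from (synchronised⇔recognisable₂ G)

    synchronised⇒recognisable : {G : ℕ → ℕ → Set} → Synchronised k G → Recognisable₂ G
    synchronised⇒recognisable {G} = Equivalence.to (synchronised⇔recognisable₂ G)

  sum⇒ind : Synchronised k (SumGraph s) → Synchronised k (IndGraph s)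
  sum⇒ind sum = recognisable⇒synchronised (recognisable-⇔ (λ (n , m) → ⇔.sym (indGraph⇔ n m)) ind)
    where
    origin : Recognisable₂ λ n m → n ≡ 0 × m ≡ 0
    origin = recognisable-× (on₁ recognisable-≡0) (on₂ recognisable-≡0)

    sumAtPredecessor : Recognisable₂ (AtPredecessor (flip (SumGraph s)))
    sumAtPredecessor = recognisable-predecessor (swapped (synchronised⇒recognisable sum))

    ind : Recognisable₂ λ n m →
      toℕ (s m) ≡ 1 × ((n ≡ 0 × m ≡ 0) ⊎ AtPredecessor (flip (SumGraph s)) n m)
    ind = recognisable-× (on₂ s≡1) (recognisable-⊎ origin sumAtPredecessor)

  ind⇒sum : Synchronised k (IndGraph s) → Synchronised k (SumGraph s)
  ind⇒sum ind = recognisable⇒synchronised (recognisable-⇔ (λ (n , m) → ⇔.sym (sumGraph⇔ n m)) sum)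
    where
    atMost : Recognisable₃ λ n _ z → z ≤ n
    atMost = recognisable-comap {P = uncurry _≤_}
      (λ ((d , _) , c) → c , d) (λ ((n , _) , z) → z , n) refl (λ _ _ → refl) recognisable-≤

    indAt : Recognisable₃ λ _ m z → IndGraph s m z
    indAt = recognisable-comap {P = uncurry (IndGraph s)}
      (λ ((_ , e) , c) → e , c) (λ ((_ , m) , z) → m , z) refl (λ _ _ → refl) (synchronised⇒recognisable ind)

    indAtMost : Recognisable₂ IndAtMost
    indAtMost = recognisable-∃≤ (recognisable-× atMost indAt)

    sum : Recognisable₂ λ n m → ¬ IndAtMost n m × (m ≡ 0 ⊎ AtPredecessor IndAtMost n m)
    sum = recognisable-× (recognisable-¬ indAtMost)
                         (recognisable-⊎ (on₂ recognisable-≡0) (recognisable-predecessor indAtMost))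

mainTheorem1 : (k : ℕ) .{{_ : NonZero k}} → 2 ≤ k →
    (s : ℕ → Fin 2) → Automatic k s →
    Synchronised k (SumGraph s) ⇔ Synchronised k (IndGraph s)
mainTheorem1 (suc (suc k₁)) (s≤s (s≤s z≤n)) s s-automatic =
  mk⇔ (sum⇒ind k₁ s s-automatic) (ind⇒sum k₁ s s-automatic)
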